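{- Let $\mathcal{B}$ be a topos. The arrow category $\mathsf{Adj}(\mathcal{B})_{=}^{\mathsf 2}$ of the category $\mathsf{Adj}(\mathcal{B})_{=}$ of internal partial orders and order adjunctions is equivalent to the factorization category $\mathsf{Ref}(\mathcal{B})\odot\mathsf{Ref}(\mathcal{B})^{\propto}$ of reflection–coreflection factorizations: \[\mathsf{Adj}(\mathcal{B})_{=}^{\mathsf 2}\equiv\mathsf{Ref}(\mathcal{B})\odot\mathsf{Ref}(\mathcal{B})^{\propto},\] the equivalence being mediated by polar factorization and composition of adjunctions.
   Context: Internal preorders/partial orders in a topos $\mathcal B$ are objects with a reflexive transitive (resp. also antisymmetric) internal relation; monotonic morphisms preserve order and are ordered pointwise internally. An order adjunction $\mathbf g=\langle\check{\mathbf g},\hat{\mathbf g}\rangle:\mathbf A_0\rightleftharpoons\mathbf A_1$ consists of monotonic $\check{\mathbf g}:\mathbf A_0\to\mathbf A_1$, $\hat{\mathbf g}:\mathbf A_1\to\mathbf A_0$ with $1\le\hat{\mathbf g}\circ\check{\mathbf g}$ and $\check{\mathbf g}\circ\hat{\mathbf g}\le1$; composition ($\mathbf g$ followed by $\mathbf h$) is $\langle\check{\mathbf h}\circ\check{\mathbf g},\hat{\mathbf g}\circ\hat{\mathbf h}\rangle$. $\mathsf{Ref}(\mathcal B)$ is the class of reflections ($\check{\mathbf g}\circ\hat{\mathbf g}=1_{A_1}$) and $\mathsf{Ref}(\mathcal B)^{\propto}$ the class of coreflections ($\hat{\mathbf g}\circ\check{\mathbf g}=1_{A_0}$). The arrow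 category $\mathsf{Adj}(\mathcal B)_{=}^{\mathsf 2}$ has objects adjunctions $(\mathbf A,\mathbf g,\mathbf B)$ and morphisms $(\mathbf a,\mathbf b):(\mathbf A_1,\mathbf g_1,\mathbf B_1)\to(\mathbf A_2,\mathbf g_2,\mathbf B_2)$ pairs of adjunctions with ($\mathbf a$ followed by $\mathbf g_2$) $=$ ($\mathbf g_1$ followed by $\mathbf b$). The category $\mathsf{Ref}(\mathcal B)\odot\mathsf{Ref}(\mathcal B)^{\propto}$ has objects quintuples $(\mathbf A,\mathbf e,\mathbf C,\mathbf m,\mathbf B)$ with $\mathbf e:\mathbf A\rightleftharpoons\mathbf C$ a reflection and $\mathbf m:\mathbf C\rightleftharpoons\mathbf B$ a coreflection between internal partial orders, and morphisms triples of adjunctions $(\mathbf a,\mathbf c,\mathbf b)$ with ($\mathbf a$ then $\mathbf e_2$) $=$ ($\mathbf e_1$ then $\mathbf c$) and ($\mathbf c$ then $\mathbf m_2$) $=$ ($\mathbf m_1$ then $\mathbf b$). Polar factorization sends an adjunction $\mathbf g$ to its factorization through its axis $\diamondsuit(\mathbf g)$ (the internal poset of pairs $(a,b)$ with $a$ closed, $b$ open, $a=\hat{\mathbf g}(b)$, $b=\check{\mathbf g}(a)$) as an extent reflection $\mathbf A_0\rightleftharpoons\diamondsuit(\mathbf g)$ followed by an intent coreflection $\diamondsuit(\mathbf g)\rightleftharpoons\mathbf A_1$; composition sends $(\mathbf A,\mathbf e,\mathbf C,\mathbf m,\mathbf B)$ to $\mathbf e$ followed by $\mathbf m$. -}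

module Defs where

open import Level using (Level; _⊔_) renaming (suc to lsuc)
open import Data.Product using (Σ; _×_; _,_; proj₁; proj₂; Σ-syntax)
import Relation.Binary.Structures as RS
open import Relation.Binary.Bundles using (Setoid)
import Relation.Binary.Reasoning.Setoid as SetoidR

record Category (o ℓ e : Level) : Set (lsuc (o ⊔ ℓ ⊔ e)) where
  infix 4 _≈_
  infixr 9 _∘_
  field
    Obj : Set o
    _⇒_ : Obj → Obj → Set ℓ
    _≈_ : ∀ {A B} → A ⇒ B → A ⇒ B → Set e
    id : ∀ {A} → A ⇒ A
    _∘_ : ∀ {A B C} → B ⇒ C → A ⇒ B → A ⇒ C
    ≈-equiv : ∀ {A B} → RS.IsEquivalence (_≈_ {A} {B})
    ∘-resp-≈ : ∀ {A B C} {f f′ : B ⇒ C} {g g′ : A ⇒ B} →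
               f ≈ f′ → g ≈ g′ → f ∘ g ≈ f′ ∘ g′
    assoc : ∀ {A B C D} {f : A ⇒ B} {g : B ⇒ C} {h : C ⇒ D} →
            (h ∘ g) ∘ f ≈ h ∘ (g ∘ f)
    identityˡ : ∀ {A B} {f : A ⇒ B} → id ∘ f ≈ f
    identityʳ : ∀ {A B} {f : A ⇒ B} → f ∘ id ≈ f

  hom-setoid : ∀ {A B} → Setoid ℓ e
  hom-setoid {A} {B} = record { Carrier = A ⇒ B ; _≈_ = _≈_ ; isEquivalence = ≈-equiv }

  module Equiv {A B : Obj} = RS.IsEquivalence (≈-equiv {A} {B})
  module HomReasoning {A B : Obj} = SetoidR (hom-setoid {A} {B})

  ∘-resp-≈ˡ : ∀ {A B C} {f f′ : B ⇒ C} {g : A ⇒ B} → f ≈ f′ → f ∘ g ≈ f′ ∘ g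
  ∘-resp-≈ˡ p = ∘-resp-≈ p Equiv.refl

  ∘-resp-≈ʳ : ∀ {A B C} {f : B ⇒ C} {g g′ : A ⇒ B} → g ≈ g′ → f ∘ g ≈ f ∘ g′
  ∘-resp-≈ʳ p = ∘-resp-≈ Equiv.refl p

module _ {o ℓ e o′ ℓ′ e′} (C : Category o ℓ e) (D : Category o′ ℓ′ e′) where
  private
    module C = Category C
    module D = Category D

  record Functor : Set (o ⊔ ℓ ⊔ e ⊔ o′ ⊔ ℓ′ ⊔ e′) where
    field
      F₀ : C.Obj → D.Obj
      F₁ : ∀ {A B} → A C.⇒ B → F₀ A D.⇒ F₀ B
      identity : ∀ {A} → F₁ (C.id {A}) D.≈ D.id
      homomorphism : ∀ {X Y Z} {f : X C.⇒ Y} {g : Y C.⇒ Z} →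
                     F₁ (g C.∘ f) D.≈ F₁ g D.∘ F₁ f
      F-resp-≈ : ∀ {A B} {f g : A C.⇒ B} → f C.≈ g → F₁ f D.≈ F₁ g

  record NaturalIsomorphism (F G : Functor) : Set (o ⊔ ℓ ⊔ e ⊔ o′ ⊔ ℓ′ ⊔ e′) where
    private
      module F = Functor F
      module G = Functor G
    field
      η : ∀ X → F.F₀ X D.⇒ G.F₀ X
      η⁻¹ : ∀ X → G.F₀ X D.⇒ F.F₀ X
      isoˡ : ∀ X → η⁻¹ X D.∘ η X D.≈ D.id
      isoʳ : ∀ X → η X D.∘ η⁻¹ X D.≈ D.id
      natural : ∀ {X Y} (f : X C.⇒ Y) → η Y D.∘ F.F₁ f D.≈ G.F₁ f D.∘ η X

idF : ∀ {o ℓ e} {C : Category o ℓ e} → Functor C C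
idF {C = C} = record
  { F₀ = λ A → A ; F₁ = λ f → f ; identity = Equiv.refl
  ; homomorphism = Equiv.refl ; F-resp-≈ = λ p → p }
  where open Category C

infixr 9 _∘F_
_∘F_ : ∀ {o ℓ e o′ ℓ′ e′ o″ ℓ″ e″}
         {C : Category o ℓ e} {D : Category o′ ℓ′ e′} {E : Category o″ ℓ″ e″} →
       Functor D E → Functor C D → Functor C E
_∘F_ {E = E} G F = record
  { F₀ = λ A → G.F₀ (F.F₀ A)
  ; F₁ = λ f → G.F₁ (F.F₁ f)
  ; identity = E.Equiv.trans (G.F-resp-≈ F.identity) G.identity
  ; homomorphism = E.Equiv.trans (G.F-resp-≈ F.homomorphism) G.homomorphism
  ; F-resp-≈ = λ p → G.F-resp-≈ (F.F-resp-≈ p)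
  }
  where
    module F = Functor F
    module G = Functor G
    module E = Category E

record IsEquivalenceOfCategories {o ℓ e o′ ℓ′ e′}
         {C : Category o ℓ e} {D : Category o′ ℓ′ e′} (F : Functor C D)
         : Set (o ⊔ ℓ ⊔ e ⊔ o′ ⊔ ℓ′ ⊔ e′) where
  field
    G : Functor D C
    unit : NaturalIsomorphism C C idF (G ∘F F)
    counit : NaturalIsomorphism D D (F ∘F G) idF

module _ {o ℓ ε} (D : Category o ℓ ε) where
  open Category D
  open HomReasoning

  record ArrowObj : Set (o ⊔ ℓ) where
    constructor arrObj
    field
      {dom} : Obj
      {cod} : Obj
      arr : dom ⇒ cod

  record ArrowHom (X Y : ArrowObj) : Set (ℓ ⊔ ε) where
    constructor arrHom
    private
      module X = ArrowObj X
      module Y = ArrowObj Y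
    field
      top : X.dom ⇒ Y.dom
      bot : X.cod ⇒ Y.cod
      square : Y.arr ∘ top ≈ bot ∘ X.arr

  private
    glue : ∀ {A B C A′ B′ C′} {f : A ⇒ A′} {g : B ⇒ B′} {h : C ⇒ C′}
             {u : A ⇒ B} {v : B ⇒ C} {u′ : A′ ⇒ B′} {v′ : B′ ⇒ C′} →
           u′ ∘ f ≈ g ∘ u → v′ ∘ g ≈ h ∘ v → (v′ ∘ u′) ∘ f ≈ h ∘ (v ∘ u)
    glue {f = f} {g} {h} {u} {v} {u′} {v′} s t = begin
      (v′ ∘ u′) ∘ f ≈⟨ assoc ⟩
      v′ ∘ (u′ ∘ f) ≈⟨ ∘-resp-≈ʳ s ⟩
      v′ ∘ (g ∘ u)  ≈⟨ Equiv.sym assoc ⟩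
      (v′ ∘ g) ∘ u  ≈⟨ ∘-resp-≈ˡ t ⟩
      (h ∘ v) ∘ u   ≈⟨ assoc ⟩
      h ∘ (v ∘ u)   ∎

    glue₂ : ∀ {A B A′ B′ A″ B″} {g : A ⇒ B} {g′ : A′ ⇒ B′} {g″ : A″ ⇒ B″}
              {a : A ⇒ A′} {b : B ⇒ B′} {a′ : A′ ⇒ A″} {b′ : B′ ⇒ B″} →
            g′ ∘ a ≈ b ∘ g → g″ ∘ a′ ≈ b′ ∘ g′ → g″ ∘ (a′ ∘ a) ≈ (b′ ∘ b) ∘ g
    glue₂ {g = g} {g′} {g″} {a} {b} {a′} {b′} s t = begin
      g″ ∘ (a′ ∘ a) ≈⟨ Equiv.sym assoc ⟩
      (g″ ∘ a′) ∘ a ≈⟨ ∘-resp-≈ˡ t ⟩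
      (b′ ∘ g′) ∘ a ≈⟨ assoc ⟩
      b′ ∘ (g′ ∘ a) ≈⟨ ∘-resp-≈ʳ s ⟩
      b′ ∘ (b ∘ g)  ≈⟨ Equiv.sym assoc ⟩
      (b′ ∘ b) ∘ g  ∎

    idsq : ∀ {A B} {g : A ⇒ B} → g ∘ id ≈ id ∘ g
    idsq = Equiv.trans identityʳ (Equiv.sym identityˡ)

  Arrow : Category (o ⊔ ℓ) (ℓ ⊔ ε) ε
  Arrow = record
    { Obj = ArrowObj
    ; _⇒_ = ArrowHom
    ; _≈_ = λ f g → (ArrowHom.top f ≈ ArrowHom.top g) × (ArrowHom.bot f ≈ ArrowHom.bot g)
    ; id = arrHom id id idsq
    ; _∘_ = λ (arrHom a′ b′ t) (arrHom a b s) → arrHom (a′ ∘ a) (b′ ∘ b) (glue₂ s t)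
    ; ≈-equiv = record
      { refl = Equiv.refl , Equiv.refl
      ; sym = λ (p , q) → Equiv.sym p , Equiv.sym q
      ; trans = λ (p , q) (p′ , q′) → Equiv.trans p p′ , Equiv.trans q q′ }
    ; ∘-resp-≈ = λ (p , q) (p′ , q′) → ∘-resp-≈ p p′ , ∘-resp-≈ q q′
    ; assoc = assoc , assoc
    ; identityˡ = identityˡ , identityˡ
    ; identityʳ = identityʳ , identityʳ
    }

  module _ {p q} (L : ∀ {A B} → A ⇒ B → Set p) (R : ∀ {A B} → A ⇒ B → Set q) where

    record FactObj : Set (o ⊔ ℓ ⊔ p ⊔ q) where
      constructor factObj
      field
        {A} {C} {B} : Obj
        e : A ⇒ C
        m : C ⇒ B
        e∈L : L e
        m∈R : R m

    record FactHom (X Y : FactObj) : Set (ℓ ⊔ ε) where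
      constructor factHom
      private
        module X = FactObj X
        module Y = FactObj Y
      field
        a : X.A ⇒ Y.A
        c : X.C ⇒ Y.C
        b : X.B ⇒ Y.B
        square₁ : Y.e ∘ a ≈ c ∘ X.e
        square₂ : Y.m ∘ c ≈ b ∘ X.m

    Fact : Category (o ⊔ ℓ ⊔ p ⊔ q) (ℓ ⊔ ε) ε
    Fact = record
      { Obj = FactObj
      ; _⇒_ = FactHom
      ; _≈_ = λ f g → (FactHom.a f ≈ FactHom.a g) × (FactHom.c f ≈ FactHom.c g)
                      × (FactHom.b f ≈ FactHom.b g)
      ; id = factHom id id id idsq idsq
      ; _∘_ = λ (factHom a′ c′ b′ s′ t′) (factHom a c b s t) →
                factHom (a′ ∘ a) (c′ ∘ c) (b′ ∘ b) (glue₂ s s′) (glue₂ t t′)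
      ; ≈-equiv = record
        { refl = Equiv.refl , Equiv.refl , Equiv.refl
        ; sym = λ (p , q , r) → Equiv.sym p , Equiv.sym q , Equiv.sym r
        ; trans = λ (p , q , r) (p′ , q′ , r′) →
                    Equiv.trans p p′ , Equiv.trans q q′ , Equiv.trans r r′ }
      ; ∘-resp-≈ = λ (p , q , r) (p′ , q′ , r′) →
                     ∘-resp-≈ p p′ , ∘-resp-≈ q q′ , ∘-resp-≈ r r′
      ; assoc = assoc , assoc , assoc
      ; identityˡ = identityˡ , identityˡ , identityˡ
      ; identityʳ = identityʳ , identityʳ , identityʳ
      }

    Compose : Functor Fact Arrow
    Compose = record
      { F₀ = λ X → arrObj (FactObj.m X ∘ FactObj.e X)
      ; F₁ = λ (factHom a c b s t) → arrHom a b (glue s t)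
      ; identity = Equiv.refl , Equiv.refl
      ; homomorphism = Equiv.refl , Equiv.refl
      ; F-resp-≈ = λ (p , q , r) → p , r
      }

module _ {o ℓ ε} (C : Category o ℓ ε) where
  open Category C

  Mono : ∀ {A B} → A ⇒ B → Set (o ⊔ ℓ ⊔ ε)
  Mono {A} f = ∀ {X} (g h : X ⇒ A) → f ∘ g ≈ f ∘ h → g ≈ h

  record IsTerminal (T : Obj) : Set (o ⊔ ℓ ⊔ ε) where
    field
      ! : ∀ {A} → A ⇒ T
      !-unique : ∀ {A} (f : A ⇒ T) → f ≈ !

  record Product (A B : Obj) : Set (o ⊔ ℓ ⊔ ε) where
    field
      A×B : Obj
      π₁ : A×B ⇒ A
      π₂ : A×B ⇒ B
      ⟨_,_⟩ : ∀ {X} → X ⇒ A → X ⇒ B → X ⇒ A×B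
      project₁ : ∀ {X} {f : X ⇒ A} {g : X ⇒ B} → π₁ ∘ ⟨ f , g ⟩ ≈ f
      project₂ : ∀ {X} {f : X ⇒ A} {g : X ⇒ B} → π₂ ∘ ⟨ f , g ⟩ ≈ g
      unique : ∀ {X} {f : X ⇒ A} {g : X ⇒ B} {h : X ⇒ A×B} →
               π₁ ∘ h ≈ f → π₂ ∘ h ≈ g → h ≈ ⟨ f , g ⟩

  record IsPullback {A B P Z} (f : A ⇒ Z) (g : B ⇒ Z) (p₁ : P ⇒ A) (p₂ : P ⇒ B)
         : Set (o ⊔ ℓ ⊔ ε) where
    field
      commute : f ∘ p₁ ≈ g ∘ p₂
      universal : ∀ {X} {h₁ : X ⇒ A} {h₂ : X ⇒ B} → f ∘ h₁ ≈ g ∘ h₂ → X ⇒ P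
      p₁∘universal : ∀ {X} {h₁ : X ⇒ A} {h₂ : X ⇒ B} (eq : f ∘ h₁ ≈ g ∘ h₂) →
                     p₁ ∘ universal eq ≈ h₁
      p₂∘universal : ∀ {X} {h₁ : X ⇒ A} {h₂ : X ⇒ B} (eq : f ∘ h₁ ≈ g ∘ h₂) →
                     p₂ ∘ universal eq ≈ h₂
      unique : ∀ {X} {h₁ : X ⇒ A} {h₂ : X ⇒ B} (eq : f ∘ h₁ ≈ g ∘ h₂) (u : X ⇒ P) →
               p₁ ∘ u ≈ h₁ → p₂ ∘ u ≈ h₂ → u ≈ universal eq

  record Pullback {A B Z} (f : A ⇒ Z) (g : B ⇒ Z) : Set (o ⊔ ℓ ⊔ ε) where
    field
      P : Obj
      p₁ : P ⇒ A
      p₂ : P ⇒ B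
      isPullback : IsPullback f g p₁ p₂

  module _ (product : ∀ A B → Product A B) where
    private
      module P {A B} = Product (product A B)

    _⁂_ : ∀ {X Y A B} → X ⇒ Y → A ⇒ B → P.A×B {X} {A} ⇒ P.A×B {Y} {B}
    f ⁂ g = P.⟨ f ∘ P.π₁ , g ∘ P.π₂ ⟩

    record Exponential (A B : Obj) : Set (o ⊔ ℓ ⊔ ε) where
      field
        B^A : Obj
        eval : P.A×B {B^A} {A} ⇒ B
        λg : ∀ {X} → P.A×B {X} {A} ⇒ B → X ⇒ B^A
        β : ∀ {X} {f : P.A×B {X} {A} ⇒ B} → eval ∘ (λg f ⁂ id) ≈ f
        λ-unique : ∀ {X} {f : P.A×B {X} {A} ⇒ B} {h : X ⇒ B^A} →
                   eval ∘ (h ⁂ id) ≈ f → h ≈ λg f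

  record IsTopos : Set (o ⊔ ℓ ⊔ ε) where
    field
      ⊤ : Obj
      terminal : IsTerminal ⊤
      product : ∀ A B → Product A B
      pullback : ∀ {A B Z} (f : A ⇒ Z) (g : B ⇒ Z) → Pullback f g
      exponential : ∀ A B → Exponential product A B
      Ω : Obj
      true : ⊤ ⇒ Ω
      classify : ∀ {S A} (m : S ⇒ A) → Mono m →
                 Σ[ χ ∈ A ⇒ Ω ] IsPullback χ true m (IsTerminal.! terminal)
      classify-unique : ∀ {S A} (m : S ⇒ A) → Mono m → (χ χ′ : A ⇒ Ω) →
                        IsPullback χ true m (IsTerminal.! terminal) →
                        IsPullback χ′ true m (IsTerminal.! terminal) → χ ≈ χ′

record Topos (o ℓ ε : Level) : Set (lsuc (o ⊔ ℓ ⊔ ε)) where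
  field
    cat : Category o ℓ ε
    isTopos : IsTopos cat

module Internal {o ℓ ε} (𝓑 : Topos o ℓ ε) where
  open Topos 𝓑
  open Category cat
  open IsTopos isTopos
  open HomReasoning
  private
    module Pr {A B} = Product (product A B)
    module Pb {A B Z} {f : A ⇒ Z} {g : B ⇒ Z} = Pullback (pullback f g)

  infixr 25 _×ᵒ_
  _×ᵒ_ : Obj → Obj → Obj
  A ×ᵒ B = Pr.A×B {A} {B}

  π₁ : ∀ {A B} → A ×ᵒ B ⇒ A
  π₁ = Pr.π₁
  π₂ : ∀ {A B} → A ×ᵒ B ⇒ B
  π₂ = Pr.π₂
  ⟨_,_⟩ : ∀ {X A B} → X ⇒ A → X ⇒ B → X ⇒ A ×ᵒ B
  ⟨ f , g ⟩ = Pr.⟨ f , g ⟩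

  swap : ∀ {A B} → A ×ᵒ B ⇒ B ×ᵒ A
  swap = ⟨ π₂ , π₁ ⟩

  -- internal partial order: object with a relation R ↣ A × A that is
  -- reflexive (Δ ⊆ R), transitive (R ∘ R ⊆ R) and antisymmetric (R ∩ R° ⊆ Δ)
  record IPoset : Set (o ⊔ ℓ ⊔ ε) where
    field
      Car : Obj
      Rel : Obj
      rel : Rel ⇒ Car ×ᵒ Car
      rel-mono : Mono cat rel
      reflexive : Σ[ d ∈ Car ⇒ Rel ] rel ∘ d ≈ ⟨ id , id ⟩
      -- R ×_A R = pullback of (π₂ ∘ rel) and (π₁ ∘ rel)
      transitive : Σ[ t ∈ Pullback.P (pullback (π₂ ∘ rel) (π₁ ∘ rel)) ⇒ Rel ]
                   rel ∘ t ≈ ⟨ π₁ ∘ (rel ∘ Pullback.p₁ (pullback (π₂ ∘ rel) (π₁ ∘ rel)))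
                             , π₂ ∘ (rel ∘ Pullback.p₂ (pullback (π₂ ∘ rel) (π₁ ∘ rel))) ⟩
      -- R ∩ R° = pullback of rel and swap ∘ rel; it is contained in the diagonal
      antisymmetric : π₁ ∘ (rel ∘ Pullback.p₁ (pullback rel (swap ∘ rel)))
                    ≈ π₂ ∘ (rel ∘ Pullback.p₁ (pullback rel (swap ∘ rel)))

  open IPoset

  Leq : (P : IPoset) {X : Obj} → X ⇒ Car P → X ⇒ Car P → Set (ℓ ⊔ ε)
  Leq P {X} f g = Σ[ h ∈ X ⇒ Rel P ] rel P ∘ h ≈ ⟨ f , g ⟩
  syntax Leq P f g = f ≤[ P ] g

  Monotone : (P Q : IPoset) → Car P ⇒ Car Q → Set (ℓ ⊔ ε)
  Monotone P Q f = (f ∘ (π₁ ∘ rel P)) ≤[ Q ] (f ∘ (π₂ ∘ rel P))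

  record Adjunction (P Q : IPoset) : Set (ℓ ⊔ ε) where
    constructor adjunction
    field
      lower : Car P ⇒ Car Q
      upper : Car Q ⇒ Car P
      lower-mono : Monotone P Q lower
      upper-mono : Monotone Q P upper
      unit : id ≤[ P ] (upper ∘ lower)
      counit : (lower ∘ upper) ≤[ Q ] id

  open Adjunction

  IsReflection : ∀ {P Q} → Adjunction P Q → Set ε
  IsReflection g = lower g ∘ upper g ≈ id

  IsCoreflection : ∀ {P Q} → Adjunction P Q → Set ε
  IsCoreflection g = upper g ∘ lower g ≈ id

  private
    ⟨⟩∘ : ∀ {X Y A B} {f : Y ⇒ A} {g : Y ⇒ B} {h : X ⇒ Y} →
          ⟨ f , g ⟩ ∘ h ≈ ⟨ f ∘ h , g ∘ h ⟩
    ⟨⟩∘ {f = f} {g} {h} = Pr.unique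
      (Equiv.trans (Equiv.sym assoc) (∘-resp-≈ˡ Pr.project₁))
      (Equiv.trans (Equiv.sym assoc) (∘-resp-≈ˡ Pr.project₂))

    ⟨⟩-cong : ∀ {X A B} {f f′ : X ⇒ A} {g g′ : X ⇒ B} →
              f ≈ f′ → g ≈ g′ → ⟨ f , g ⟩ ≈ ⟨ f′ , g′ ⟩
    ⟨⟩-cong p q = Pr.unique (Equiv.trans Pr.project₁ p) (Equiv.trans Pr.project₂ q)

    ⟨⟩-η : ∀ {X A B} {h : X ⇒ A ×ᵒ B} → h ≈ ⟨ π₁ ∘ h , π₂ ∘ h ⟩
    ⟨⟩-η = Pr.unique Equiv.refl Equiv.refl

  module _ {P : IPoset} where

    ≤-resp : ∀ {X} {f f′ g g′ : X ⇒ Car P} → f ≈ f′ → g ≈ g′ →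
             f ≤[ P ] g → f′ ≤[ P ] g′
    ≤-resp p q (h , eq) = h , Equiv.trans eq (⟨⟩-cong p q)

    ≤-∘ʳ : ∀ {X Y} {f g : Y ⇒ Car P} (k : X ⇒ Y) →
           f ≤[ P ] g → (f ∘ k) ≤[ P ] (g ∘ k)
    ≤-∘ʳ k (h , eq) = h ∘ k , Equiv.trans (Equiv.sym assoc)
                                (Equiv.trans (∘-resp-≈ˡ eq) ⟨⟩∘)

    ≤-refl : ∀ {X} {f : X ⇒ Car P} → f ≤[ P ] f
    ≤-refl {f = f} with reflexive P
    ... | d , eq = d ∘ f , (begin
      rel P ∘ (d ∘ f)   ≈⟨ Equiv.sym assoc ⟩
      (rel P ∘ d) ∘ f   ≈⟨ ∘-resp-≈ˡ eq ⟩
      ⟨ id , id ⟩ ∘ f   ≈⟨ ⟨⟩∘ ⟩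
      ⟨ id ∘ f , id ∘ f ⟩ ≈⟨ ⟨⟩-cong identityˡ identityˡ ⟩
      ⟨ f , f ⟩ ∎)

    ≤-trans : ∀ {X} {f g k : X ⇒ Car P} →
              f ≤[ P ] g → g ≤[ P ] k → f ≤[ P ] k
    ≤-trans {X} {f} {g} {k} (h₁ , e₁) (h₂ , e₂) with transitive P
    ... | t , et = t ∘ u , (begin
        rel P ∘ (t ∘ u) ≈⟨ Equiv.sym assoc ⟩
        (rel P ∘ t) ∘ u ≈⟨ ∘-resp-≈ˡ et ⟩
        ⟨ π₁ ∘ (rel P ∘ p₁) , π₂ ∘ (rel P ∘ p₂) ⟩ ∘ u ≈⟨ ⟨⟩∘ ⟩
        ⟨ (π₁ ∘ (rel P ∘ p₁)) ∘ u , (π₂ ∘ (rel P ∘ p₂)) ∘ u ⟩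
          ≈⟨ ⟨⟩-cong (side π₁ p₁ h₁ (IsPullback.p₁∘universal ipb c)
                        (Equiv.trans (∘-resp-≈ʳ e₁) Pr.project₁))
                     (side π₂ p₂ h₂ (IsPullback.p₂∘universal ipb c)
                        (Equiv.trans (∘-resp-≈ʳ e₂) Pr.project₂)) ⟩
        ⟨ f , k ⟩ ∎)
      where
        pb = pullback (π₂ ∘ rel P) (π₁ ∘ rel P)
        p₁ = Pullback.p₁ pb
        p₂ = Pullback.p₂ pb
        ipb = Pullback.isPullback pb
        c : (π₂ ∘ rel P) ∘ h₁ ≈ (π₁ ∘ rel P) ∘ h₂
        c = begin
          (π₂ ∘ rel P) ∘ h₁ ≈⟨ assoc ⟩
          π₂ ∘ (rel P ∘ h₁) ≈⟨ ∘-resp-≈ʳ e₁ ⟩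
          π₂ ∘ ⟨ f , g ⟩    ≈⟨ Pr.project₂ ⟩
          g                 ≈⟨ Equiv.sym Pr.project₁ ⟩
          π₁ ∘ ⟨ g , k ⟩    ≈⟨ Equiv.sym (∘-resp-≈ʳ e₂) ⟩
          π₁ ∘ (rel P ∘ h₂) ≈⟨ Equiv.sym assoc ⟩
          (π₁ ∘ rel P) ∘ h₂ ∎
        u = IsPullback.universal ipb c
        side : (π : Car P ×ᵒ Car P ⇒ Car P) (p : Pullback.P pb ⇒ Rel P)
                 (h : X ⇒ Rel P) {z : X ⇒ Car P} →
               p ∘ u ≈ h → π ∘ (rel P ∘ h) ≈ z → (π ∘ (rel P ∘ p)) ∘ u ≈ z
        side π p h q r = Equiv.trans assoc (Equiv.trans (∘-resp-≈ʳ assoc)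
                           (Equiv.trans (∘-resp-≈ʳ (∘-resp-≈ʳ q)) r))

  ≤-mono : ∀ {P Q} {m : Car P ⇒ Car Q} {X} {f g : X ⇒ Car P} →
           Monotone P Q m → f ≤[ P ] g → (m ∘ f) ≤[ Q ] (m ∘ g)
  ≤-mono {P} {Q} {m} {f = f} {g} mm (h , eq) =
    ≤-resp {Q} (side π₁ Pr.project₁) (side π₂ Pr.project₂) (≤-∘ʳ {Q} h mm)
    where
      side : ∀ {z} (π : Car P ×ᵒ Car P ⇒ Car P) → π ∘ ⟨ f , g ⟩ ≈ z →
             (m ∘ (π ∘ rel P)) ∘ h ≈ m ∘ z
      side π q = Equiv.trans assoc (∘-resp-≈ʳ (Equiv.trans assoc
                   (Equiv.trans (∘-resp-≈ʳ eq) q)))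

  mono-id : ∀ {P} → Monotone P P id
  mono-id {P} = id , Equiv.trans identityʳ
    (Equiv.trans ⟨⟩-η (⟨⟩-cong (Equiv.sym identityˡ) (Equiv.sym identityˡ)))

  mono-∘ : ∀ {P Q S} {f : Car P ⇒ Car Q} {g : Car Q ⇒ Car S} →
           Monotone P Q f → Monotone Q S g → Monotone P S (g ∘ f)
  mono-∘ {P} {Q} {S} {f} {g} mf mg =
    ≤-resp {S} (Equiv.sym assoc) (Equiv.sym assoc) (≤-mono {Q} {S} {g} mg mf)

  idAdj : ∀ {P} → Adjunction P P
  idAdj {P} = adjunction id id (mono-id {P}) (mono-id {P})
    (≤-resp {P} Equiv.refl (Equiv.sym identityˡ) (≤-refl {P}))
    (≤-resp {P} (Equiv.sym identityˡ) Equiv.refl (≤-refl {P}))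

  _∘ᴬ_ : ∀ {P Q S} → Adjunction Q S → Adjunction P Q → Adjunction P S
  _∘ᴬ_ {P} {Q} {S} h g = adjunction (lower h ∘ lower g) (upper g ∘ upper h)
    (mono-∘ {P} {Q} {S} (lower-mono g) (lower-mono h))
    (mono-∘ {S} {Q} {P} (upper-mono h) (upper-mono g))
    (≤-trans {P} (unit g)
      (≤-resp {P} (∘-resp-≈ʳ identityˡ)
         (Equiv.trans (∘-resp-≈ʳ assoc) (Equiv.sym assoc))
         (≤-mono {Q} {P} {upper g} (upper-mono g) (≤-∘ʳ {Q} (lower g) (unit h)))))
    (≤-trans {S}
      (≤-resp {S} (Equiv.trans (∘-resp-≈ʳ assoc) (Equiv.sym assoc))
         (∘-resp-≈ʳ identityˡ)
         (≤-mono {Q} {S} {lower h} (lower-mono h) (≤-∘ʳ {Q} (upper h) (counit g))))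
      (counit h))

  -- Adj(𝓑)_= : internal partial orders and order adjunctions,
  -- adjunctions being equal when their components are equal
  AdjCat : Category (o ⊔ ℓ ⊔ ε) (ℓ ⊔ ε) ε
  AdjCat = record
    { Obj = IPoset
    ; _⇒_ = Adjunction
    ; _≈_ = λ g h → (lower g ≈ lower h) × (upper g ≈ upper h)
    ; id = idAdj
    ; _∘_ = _∘ᴬ_
    ; ≈-equiv = record
      { refl = Equiv.refl , Equiv.refl
      ; sym = λ (p , q) → Equiv.sym p , Equiv.sym q
      ; trans = λ (p , q) (p′ , q′) → Equiv.trans p p′ , Equiv.trans q q′ }
    ; ∘-resp-≈ = λ (p , q) (p′ , q′) → ∘-resp-≈ p p′ , ∘-resp-≈ q′ q
    ; assoc = assoc , Equiv.sym assoc
    ; identityˡ = identityˡ , identityʳ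
    ; identityʳ = identityʳ , identityˡ
    }

  AdjArrow : Category (o ⊔ ℓ ⊔ ε) (ℓ ⊔ ε) ε
  AdjArrow = Arrow AdjCat

  RefCoref : Category (o ⊔ ℓ ⊔ ε) (ℓ ⊔ ε) ε
  RefCoref = Fact AdjCat IsReflection IsCoreflection

  Composition : Functor RefCoref AdjArrow
  Composition = Compose AdjCat IsReflection IsCoreflection

-- For an adjunction g = ⟨ ǧ , ĝ ⟩ : P ⇌ Q, antisymmetry turns the unit and counit
-- inequalities into the triangle identities ǧ ĝ ǧ = ǧ and ĝ ǧ ĝ = ĝ, so the closure
-- k = ĝ ǧ is idempotent. Its fixed points, with the order induced from P, form the
-- axis: k corestricts to a reflection P ⇌ ◇(g), ǧ restricts to a coreflection
-- ◇(g) ⇌ Q, and the two compose back to g on the nose, which makes the counit an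
-- identity. A commuting square of adjunctions sends closed elements to closed
-- elements, giving functoriality. Conversely, for a reflection e followed by a
-- coreflection m the closure of the composite is ê ě, whose fixed points are exactly
-- the image of ê; so ê and ě ∘ i identify the middle object with the axis, which
-- is the unit.
module Submission where

open import Level using (_⊔_)
open import Data.Product using (Σ-syntax; _,_; proj₁; proj₂)
open import Defs

module PolarFactorization {o ℓ ε} (𝓑 : Topos o ℓ ε) where
  open Topos 𝓑
  open Category cat
  open IsTopos isTopos
  open Internal 𝓑
  open IPoset
  open Adjunction
  open Equiv using (refl; sym)
  private
    module Pr {A B} = Product (product A B)

  infixr 5 _○_
  _○_ : ∀ {A B} {f g h : A ⇒ B} → f ≈ g → g ≈ h → f ≈ h
  _○_ = Equiv.trans

  abstract
    pullˡ : ∀ {W X Y Z} {a : Y ⇒ Z} {b : X ⇒ Y} {c : X ⇒ Z} {f : W ⇒ X} →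
            a ∘ b ≈ c → a ∘ (b ∘ f) ≈ c ∘ f
    pullˡ e = sym assoc ○ ∘-resp-≈ˡ e

    pullʳ : ∀ {W X Y Z} {a : Y ⇒ Z} {b : X ⇒ Y} {c : W ⇒ Y} {f : W ⇒ X} →
            b ∘ f ≈ c → (a ∘ b) ∘ f ≈ a ∘ c
    pullʳ e = assoc ○ ∘-resp-≈ʳ e

    ⟨⟩∘ : ∀ {X Y A B} {f : Y ⇒ A} {g : Y ⇒ B} {h : X ⇒ Y} →
          ⟨ f , g ⟩ ∘ h ≈ ⟨ f ∘ h , g ∘ h ⟩
    ⟨⟩∘ = Pr.unique (pullˡ Pr.project₁) (pullˡ Pr.project₂)

    ⟨⟩-cong : ∀ {X A B} {f f′ : X ⇒ A} {g g′ : X ⇒ B} →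
              f ≈ f′ → g ≈ g′ → ⟨ f , g ⟩ ≈ ⟨ f′ , g′ ⟩
    ⟨⟩-cong p q = Pr.unique (Pr.project₁ ○ p) (Pr.project₂ ○ q)

    ⟨⟩-η : ∀ {X A B} {h : X ⇒ A ×ᵒ B} → h ≈ ⟨ π₁ ∘ h , π₂ ∘ h ⟩
    ⟨⟩-η = Pr.unique refl refl

    ⟨⟩∘-injective₁ : ∀ {X Y Z A B} {a : Y ⇒ A} {b : Y ⇒ B} {c : Z ⇒ A} {d : Z ⇒ B}
                       {x : X ⇒ Y} {y : X ⇒ Z} →
                     ⟨ a , b ⟩ ∘ x ≈ ⟨ c , d ⟩ ∘ y → a ∘ x ≈ c ∘ y
    ⟨⟩∘-injective₁ e =
      ∘-resp-≈ˡ (sym Pr.project₁) ○ assoc ○ ∘-resp-≈ʳ e ○ pullˡ Pr.project₁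

    ⟨⟩∘-injective₂ : ∀ {X Y Z A B} {a : Y ⇒ A} {b : Y ⇒ B} {c : Z ⇒ A} {d : Z ⇒ B}
                       {x : X ⇒ Y} {y : X ⇒ Z} →
                     ⟨ a , b ⟩ ∘ x ≈ ⟨ c , d ⟩ ∘ y → b ∘ x ≈ d ∘ y
    ⟨⟩∘-injective₂ e =
      ∘-resp-≈ˡ (sym Pr.project₂) ○ assoc ○ ∘-resp-≈ʳ e ○ pullˡ Pr.project₂

    pullback-jointly-monic :
      ∀ {A B W Z X} {f : A ⇒ Z} {g : B ⇒ Z} {p₁ : W ⇒ A} {p₂ : W ⇒ B} →
      IsPullback cat f g p₁ p₂ → {u v : X ⇒ W} →
      p₁ ∘ u ≈ p₁ ∘ v → p₂ ∘ u ≈ p₂ ∘ v → u ≈ v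
    pullback-jointly-monic {W = W} {X = X} {f} {g} {p₁} {p₂} pb {u} {v} e₁ e₂ =
      IsPullback.unique pb commutes u e₁ e₂ ○ sym (IsPullback.unique pb commutes v refl refl)
      where
        commutes : ∀ {w : X ⇒ W} → f ∘ (p₁ ∘ w) ≈ g ∘ (p₂ ∘ w)
        commutes = sym assoc ○ ∘-resp-≈ˡ (IsPullback.commute pb) ○ assoc

  abstract
    ≤-antisym : ∀ (P : IPoset) {X} {f g : X ⇒ Car P} → f ≤[ P ] g → g ≤[ P ] f → f ≈ g
    ≤-antisym P {X} {f} {g} (h₁ , e₁) (h₂ , e₂) =
      sym Pr.project₁ ○ ∘-resp-≈ʳ (sym e₁) ○ ∘-resp-≈ʳ (∘-resp-≈ʳ (sym p₁∘u))
      ○ sym (pullʳ assoc) ○ ∘-resp-≈ˡ (antisymmetric P) ○ pullʳ assoc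
      ○ ∘-resp-≈ʳ (∘-resp-≈ʳ p₁∘u) ○ ∘-resp-≈ʳ e₁ ○ Pr.project₂
      where
        open Pullback (pullback (rel P) (swap ∘ rel P)) using (p₁; isPullback)
        ⟨f,g⟩∈R∩R° : rel P ∘ h₁ ≈ (swap ∘ rel P) ∘ h₂
        ⟨f,g⟩∈R∩R° = e₁ ○ ⟨⟩-cong (sym Pr.project₂) (sym Pr.project₁) ○ sym ⟨⟩∘
                     ○ ∘-resp-≈ʳ (sym e₂) ○ sym assoc
        p₁∘u : p₁ ∘ IsPullback.universal isPullback ⟨f,g⟩∈R∩R° ≈ h₁
        p₁∘u = IsPullback.p₁∘universal isPullback ⟨f,g⟩∈R∩R°

    ≈⇒≤ : ∀ (P : IPoset) {X} {f g : X ⇒ Car P} → f ≈ g → f ≤[ P ] g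
    ≈⇒≤ P e = ≤-resp {P} refl e (≤-refl {P})

  isoAdjunction : ∀ {P Q : IPoset} (f : Car P ⇒ Car Q) (h : Car Q ⇒ Car P) →
                  Monotone P Q f → Monotone Q P h → h ∘ f ≈ id → f ∘ h ≈ id →
                  Adjunction P Q
  isoAdjunction {P} {Q} f h mf mh hf fh =
    adjunction f h mf mh (≈⇒≤ P (sym hf)) (≈⇒≤ Q fh)

  module InducedOrder (P : IPoset) {E : Obj} (i : E ⇒ Car P) (i-mono : Mono cat i) where
    private
      i×i : E ×ᵒ E ⇒ Car P ×ᵒ Car P
      i×i = ⟨ i ∘ π₁ , i ∘ π₂ ⟩
      restricted : Pullback cat (rel P) i×i
      restricted = pullback (rel P) i×i
      open Pullback restricted renaming (P to R; p₁ to q₁; p₂ to q₂; isPullback to pb)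

      -- f ≼ g is f ≤[ Sub ] g, available before Sub is defined.
      _≼_ : ∀ {X} → X ⇒ E → X ⇒ E → Set (ℓ ⊔ ε)
      _≼_ {X} f g = Σ[ h ∈ X ⇒ R ] q₂ ∘ h ≈ ⟨ f , g ⟩

      abstract
        i×i∘⟨⟩ : ∀ {X} {f g : X ⇒ E} → i×i ∘ ⟨ f , g ⟩ ≈ ⟨ i ∘ f , i ∘ g ⟩
        i×i∘⟨⟩ = ⟨⟩∘ ○ ⟨⟩-cong (pullʳ Pr.project₁) (pullʳ Pr.project₂)

    abstract
      preserves-≤ : ∀ {X} {f g : X ⇒ E} → f ≼ g → (i ∘ f) ≤[ P ] (i ∘ g)
      preserves-≤ (h , eq) = q₁ ∘ h , (pullˡ (IsPullback.commute pb) ○ pullʳ eq ○ i×i∘⟨⟩)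

      reflects-≤ : ∀ {X} {f g : X ⇒ E} → (i ∘ f) ≤[ P ] (i ∘ g) → f ≼ g
      reflects-≤ (h , eq) =
        IsPullback.universal pb (eq ○ sym i×i∘⟨⟩) , IsPullback.p₂∘universal pb _

    private
      ≼-self : ∀ {X} (x : X ⇒ R) → (π₁ ∘ (q₂ ∘ x)) ≼ (π₂ ∘ (q₂ ∘ x))
      ≼-self x = x , ⟨⟩-η

      abstract
        q₂-mono : Mono cat q₂
        q₂-mono u v e = pullback-jointly-monic pb (rel-mono P _ _ rel∘q₁) e
          where
            rel∘q₁ : rel P ∘ (q₁ ∘ u) ≈ rel P ∘ (q₁ ∘ v)
            rel∘q₁ = pullˡ (IsPullback.commute pb) ○ pullʳ e ○ sym assoc
                     ○ sym (pullˡ (IsPullback.commute pb))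

        transitive′ : (π₁ ∘ (q₂ ∘ Pullback.p₁ (pullback (π₂ ∘ q₂) (π₁ ∘ q₂))))
                    ≼ (π₂ ∘ (q₂ ∘ Pullback.p₂ (pullback (π₂ ∘ q₂) (π₁ ∘ q₂))))
        transitive′ = reflects-≤ (≤-trans {P} (preserves-≤ (≼-self t₁))
                        (≤-resp {P} (∘-resp-≈ʳ middle) refl (preserves-≤ (≼-self t₂))))
          where
            open Pullback (pullback (π₂ ∘ q₂) (π₁ ∘ q₂)) using (isPullback) renaming (p₁ to t₁; p₂ to t₂)
            middle : π₁ ∘ (q₂ ∘ t₂) ≈ π₂ ∘ (q₂ ∘ t₁)
            middle = sym assoc ○ sym (IsPullback.commute isPullback) ○ assoc

        antisymmetric′ : π₁ ∘ (q₂ ∘ Pullback.p₁ (pullback q₂ (swap ∘ q₂)))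
                       ≈ π₂ ∘ (q₂ ∘ Pullback.p₁ (pullback q₂ (swap ∘ q₂)))
        antisymmetric′ = i-mono _ _
          (≤-antisym P (preserves-≤ (≼-self a₁)) (preserves-≤ (a₂ , swapped)))
          where
            open Pullback (pullback q₂ (swap ∘ q₂)) using (isPullback) renaming (p₁ to a₁; p₂ to a₂)
            commutes : q₂ ∘ a₁ ≈ swap ∘ (q₂ ∘ a₂)
            commutes = IsPullback.commute isPullback ○ assoc
            swapped : q₂ ∘ a₂ ≈ ⟨ π₂ ∘ (q₂ ∘ a₁) , π₁ ∘ (q₂ ∘ a₁) ⟩
            swapped = ⟨⟩-η ○ ⟨⟩-cong (sym (∘-resp-≈ʳ commutes ○ pullˡ Pr.project₂))
                                      (sym (∘-resp-≈ʳ commutes ○ pullˡ Pr.project₁))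

    Sub : IPoset
    Sub = record
      { Car = E ; Rel = R ; rel = q₂ ; rel-mono = q₂-mono
      ; reflexive = reflects-≤ (≤-refl {P})
      ; transitive = transitive′
      ; antisymmetric = antisymmetric′ }

    i-monotone : Monotone Sub P i
    i-monotone = preserves-≤ (id , (identityʳ ○ ⟨⟩-η))

    corestriction-monotone : ∀ {S : IPoset} (y : Car S ⇒ E) (f : Car S ⇒ Car P) →
                             i ∘ y ≈ f → Monotone S P f → Monotone S Sub y
    corestriction-monotone y f e mf =
      reflects-≤ (≤-resp {P} (sym (pullˡ e)) (sym (pullˡ e)) mf)

  -- The paper's axis consists of pairs (a , ǧ a) with a closed; since the second
  -- component is determined by the first, ◇(g) is modelled by the closed elements
  -- alone, i.e. the equaliser of k and id, built as the pullback of ⟨ id , k ⟩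
  -- along the diagonal.
  module Axis {P Q : IPoset} (g : Adjunction P Q) where
    ǧ : Car P ⇒ Car Q
    ǧ = lower g

    ĝ : Car Q ⇒ Car P
    ĝ = upper g

    k : Car P ⇒ Car P
    k = ĝ ∘ ǧ

    abstract
      ǧĝǧ≈ǧ : ǧ ∘ (ĝ ∘ ǧ) ≈ ǧ
      ǧĝǧ≈ǧ = ≤-antisym Q
        (≤-resp {Q} assoc identityˡ (≤-∘ʳ {Q} ǧ (counit g)))
        (≤-resp {Q} identityʳ refl (≤-mono {P} {Q} {ǧ} (lower-mono g) (unit g)))

      ĝǧĝ≈ĝ : ĝ ∘ (ǧ ∘ ĝ) ≈ ĝ
      ĝǧĝ≈ĝ = ≤-antisym P
        (≤-resp {P} refl identityʳ (≤-mono {Q} {P} {ĝ} (upper-mono g) (counit g)))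
        (≤-resp {P} identityˡ assoc (≤-∘ʳ {P} ĝ (unit g)))

      k∘k≈k : k ∘ k ≈ k
      k∘k≈k = pullʳ ǧĝǧ≈ǧ

      k∘ĝ≈ĝ : k ∘ ĝ ≈ ĝ
      k∘ĝ≈ĝ = assoc ○ ĝǧĝ≈ĝ

      ǧ∘k : ∀ {X} {y : X ⇒ Car P} → ǧ ∘ (k ∘ y) ≈ ǧ ∘ y
      ǧ∘k = pullˡ ǧĝǧ≈ǧ

      k-cong-ǧ : ∀ {X} {z z′ : X ⇒ Car P} → ǧ ∘ z ≈ ǧ ∘ z′ → k ∘ z ≈ k ∘ z′
      k-cong-ǧ e = pullʳ e ○ sym assoc

    k-monotone : Monotone P P k
    k-monotone = mono-∘ {P} {Q} {P} (lower-mono g) (upper-mono g)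

    private
      closed : Pullback cat ⟨ id , k ⟩ ⟨ id , id ⟩
      closed = pullback ⟨ id , k ⟩ ⟨ id , id ⟩
      open Pullback closed using (p₂) renaming (isPullback to equaliser)

    E : Obj
    E = Pullback.P closed

    i : E ⇒ Car P
    i = Pullback.p₁ closed

    abstract
      private
        i≈p₂ : i ≈ p₂
        i≈p₂ = sym identityˡ ○ ⟨⟩∘-injective₁ (IsPullback.commute equaliser) ○ identityˡ

      k∘i≈i : k ∘ i ≈ i
      k∘i≈i = ⟨⟩∘-injective₂ (IsPullback.commute equaliser) ○ identityˡ ○ sym i≈p₂

      i-mono : Mono cat i
      i-mono u v e = pullback-jointly-monic equaliser e
        (∘-resp-≈ˡ (sym i≈p₂) ○ e ○ ∘-resp-≈ˡ i≈p₂)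

      corestrict : ∀ {X} (x : X ⇒ Car P) → k ∘ x ≈ x → X ⇒ E
      corestrict x kx = IsPullback.universal equaliser
        (⟨⟩∘ ○ ⟨⟩-cong (identityˡ ○ sym identityˡ) (kx ○ sym identityˡ) ○ sym ⟨⟩∘)

      i∘corestrict : ∀ {X} (x : X ⇒ Car P) (kx : k ∘ x ≈ x) → i ∘ corestrict x kx ≈ x
      i∘corestrict x kx = IsPullback.p₁∘universal equaliser _

    module ◇ = InducedOrder P i i-mono

    ◇ : IPoset
    ◇ = ◇.Sub

    r : Car P ⇒ E
    r = corestrict k k∘k≈k

    s : Car Q ⇒ E
    s = corestrict ĝ k∘ĝ≈ĝ

    abstract
      i∘r≈k : i ∘ r ≈ k
      i∘r≈k = i∘corestrict k k∘k≈k

      i∘s≈ĝ : i ∘ s ≈ ĝ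
      i∘s≈ĝ = i∘corestrict ĝ k∘ĝ≈ĝ

      r∘i≈id : r ∘ i ≈ id
      r∘i≈id = i-mono _ _ (pullˡ i∘r≈k ○ k∘i≈i ○ sym identityʳ)

      s∘ǧ∘i≈id : s ∘ (ǧ ∘ i) ≈ id
      s∘ǧ∘i≈id = i-mono _ _ (pullˡ i∘s≈ĝ ○ sym assoc ○ k∘i≈i ○ sym identityʳ)

      ǧ∘i∘r≈ǧ : (ǧ ∘ i) ∘ r ≈ ǧ
      ǧ∘i∘r≈ǧ = pullʳ i∘r≈k ○ ǧĝǧ≈ǧ

    extent : Adjunction P ◇
    extent = adjunction r i (◇.corestriction-monotone {P} r k i∘r≈k k-monotone) ◇.i-monotone
      (≤-resp {P} refl (sym i∘r≈k) (unit g))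
      (≈⇒≤ ◇ r∘i≈id)

    intent : Adjunction ◇ Q
    intent = adjunction (ǧ ∘ i) s (mono-∘ {◇} {P} {Q} ◇.i-monotone (lower-mono g))
      (◇.corestriction-monotone {Q} s ĝ i∘s≈ĝ (upper-mono g))
      (≈⇒≤ ◇ (sym s∘ǧ∘i≈id))
      (≤-resp {Q} (sym (pullʳ i∘s≈ĝ)) refl (counit g))

    polar : Category.Obj RefCoref
    polar = factObj extent intent r∘i≈id s∘ǧ∘i≈id

    intent∘extent≈g : Category._≈_ AdjCat (intent ∘ᴬ extent) g
    intent∘extent≈g = ǧ∘i∘r≈ǧ , i∘s≈ĝ

  -- A square (a , b) : g₁ → g₂ induces c : ◇(g₁) ⇌ ◇(g₂) with č = k₂ ǎ and ĉ = â
  -- on closed elements; â preserves closedness since â ĝ₂ = ĝ₁ b̂.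
  module AxisHom {X Y : Category.Obj AdjArrow} (f : Category._⇒_ AdjArrow X Y) where
    module A₁ = Axis (ArrowObj.arr X)
    module A₂ = Axis (ArrowObj.arr Y)
    open ArrowHom f renaming (top to a; bot to b)

    P₁ P₂ : IPoset
    P₁ = ArrowObj.dom X
    P₂ = ArrowObj.dom Y

    private
      ǎ : Car P₁ ⇒ Car P₂
      ǎ = lower a
      â : Car P₂ ⇒ Car P₁
      â = upper a
      lower-square : A₂.ǧ ∘ ǎ ≈ lower b ∘ A₁.ǧ
      lower-square = proj₁ square
      upper-square : â ∘ A₂.ĝ ≈ A₁.ĝ ∘ upper b
      upper-square = proj₂ square

    abstract
      ǧ₂∘ǎ∘k₁ : A₂.ǧ ∘ (ǎ ∘ A₁.k) ≈ A₂.ǧ ∘ ǎ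
      ǧ₂∘ǎ∘k₁ = pullˡ lower-square ○ pullʳ A₁.ǧĝǧ≈ǧ ○ sym lower-square

      ǧ₂∘ǎ∘k₁∘ : ∀ {Z} {y : Z ⇒ Car P₁} → A₂.ǧ ∘ (ǎ ∘ (A₁.k ∘ y)) ≈ A₂.ǧ ∘ (ǎ ∘ y)
      ǧ₂∘ǎ∘k₁∘ = ∘-resp-≈ʳ (sym assoc) ○ pullˡ ǧ₂∘ǎ∘k₁ ○ assoc

    private
      abstract
        k₁∘â∘ĝ₂ : A₁.k ∘ (â ∘ A₂.ĝ) ≈ â ∘ A₂.ĝ
        k₁∘â∘ĝ₂ = ∘-resp-≈ʳ upper-square ○ pullˡ A₁.k∘ĝ≈ĝ ○ sym upper-square

        â∘i₂ : â ∘ A₂.i ≈ (â ∘ A₂.ĝ) ∘ (A₂.ǧ ∘ A₂.i)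
        â∘i₂ = ∘-resp-≈ʳ (sym A₂.k∘i≈i ○ assoc) ○ sym assoc

        k₁∘â∘i₂ : A₁.k ∘ (â ∘ A₂.i) ≈ â ∘ A₂.i
        k₁∘â∘i₂ = ∘-resp-≈ʳ â∘i₂ ○ pullˡ k₁∘â∘ĝ₂ ○ sym â∘i₂

    č : A₁.E ⇒ A₂.E
    č = A₂.r ∘ (ǎ ∘ A₁.i)

    ĉ : A₂.E ⇒ A₁.E
    ĉ = A₁.corestrict (â ∘ A₂.i) k₁∘â∘i₂

    abstract
      i₁∘ĉ : A₁.i ∘ ĉ ≈ â ∘ A₂.i
      i₁∘ĉ = A₁.i∘corestrict (â ∘ A₂.i) k₁∘â∘i₂

    c : Adjunction A₁.◇ A₂.◇
    c = adjunction č ĉ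
      (mono-∘ {A₁.◇} {P₂} {A₂.◇}
        (mono-∘ {A₁.◇} {P₁} {P₂} A₁.◇.i-monotone (lower-mono a))
        (lower-mono A₂.extent))
      (A₁.◇.corestriction-monotone {A₂.◇} ĉ (â ∘ A₂.i) i₁∘ĉ
        (mono-∘ {A₂.◇} {P₂} {P₁} A₂.◇.i-monotone (upper-mono a)))
      (A₁.◇.reflects-≤ (≤-trans {P₁}
        (≤-resp {P₁} (identityˡ ○ sym identityʳ) assoc (≤-∘ʳ {P₁} A₁.i (unit a)))
        (≤-resp {P₁} (∘-resp-≈ʳ identityˡ) (sym i₁∘ĉ∘č)
          (≤-mono {P₂} {P₁} {â} (upper-mono a)
            (≤-∘ʳ {P₂} (ǎ ∘ A₁.i) (unit (ArrowObj.arr Y)))))))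
      (A₂.◇.reflects-≤ (≤-resp {P₂} (sym i₂∘č∘ĉ) (∘-resp-≈ʳ identityˡ ○ A₂.k∘i≈i ○ sym identityʳ)
        (≤-mono {P₂} {P₂} {A₂.k} A₂.k-monotone (≤-∘ʳ {P₂} A₂.i (counit a)))))
      where
        i₁∘ĉ∘č : A₁.i ∘ (ĉ ∘ č) ≈ â ∘ (A₂.k ∘ (ǎ ∘ A₁.i))
        i₁∘ĉ∘č = pullˡ i₁∘ĉ ○ assoc ○ ∘-resp-≈ʳ (pullˡ A₂.i∘r≈k)
        i₂∘č∘ĉ : A₂.i ∘ (č ∘ ĉ) ≈ A₂.k ∘ ((ǎ ∘ â) ∘ A₂.i)
        i₂∘č∘ĉ = ∘-resp-≈ʳ assoc ○ pullˡ A₂.i∘r≈k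
                 ○ ∘-resp-≈ʳ (assoc ○ ∘-resp-≈ʳ i₁∘ĉ ○ sym assoc)

    abstract
      extent-square : Category._≈_ AdjCat (A₂.extent ∘ᴬ a) (c ∘ᴬ A₁.extent)
      extent-square = A₂.i-mono _ _ (pullˡ A₂.i∘r≈k ○ sym i₂∘č∘r₁) , sym i₁∘ĉ
        where
          i₂∘č∘r₁ : A₂.i ∘ (č ∘ A₁.r) ≈ A₂.k ∘ ǎ
          i₂∘č∘r₁ = ∘-resp-≈ʳ assoc ○ pullˡ A₂.i∘r≈k
                    ○ ∘-resp-≈ʳ (pullʳ A₁.i∘r≈k) ○ A₂.k-cong-ǧ ǧ₂∘ǎ∘k₁

      intent-square : Category._≈_ AdjCat (A₂.intent ∘ᴬ c) (b ∘ᴬ A₁.intent)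
      intent-square =
          (assoc ○ ∘-resp-≈ʳ (pullˡ A₂.i∘r≈k) ○ A₂.ǧ∘k ○ pullˡ lower-square ○ assoc)
        , A₁.i-mono _ _ (pullˡ i₁∘ĉ ○ pullʳ A₂.i∘s≈ĝ ○ upper-square
                         ○ ∘-resp-≈ˡ (sym A₁.i∘s≈ĝ) ○ assoc)

    hom : Category._⇒_ RefCoref (A₁.polar) (A₂.polar)
    hom = factHom a c b extent-square intent-square

  Polar : Functor AdjArrow RefCoref
  Polar = record
    { F₀ = λ X → Axis.polar (ArrowObj.arr X)
    ; F₁ = AxisHom.hom
    ; identity = identity
    ; homomorphism = homomorphism
    ; F-resp-≈ = resp-≈
    }
    where
      abstract
        identity : ∀ {X} → Category._≈_ RefCoref (AxisHom.hom (Category.id AdjArrow {X}))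
                                                 (Category.id RefCoref)
        identity {X} =
            (refl , refl)
          , ( i-mono _ _ (pullˡ i∘r≈k ○ ∘-resp-≈ʳ identityˡ ○ k∘i≈i ○ sym identityʳ)
            , i-mono _ _ (AxisHom.i₁∘ĉ (Category.id AdjArrow {X}) ○ identityˡ ○ sym identityʳ))
          , (refl , refl)
          where open Axis (ArrowObj.arr X)

        homomorphism : ∀ {X Y Z} {f : Category._⇒_ AdjArrow X Y} {h : Category._⇒_ AdjArrow Y Z} →
                       Category._≈_ RefCoref (AxisHom.hom (Category._∘_ AdjArrow h f))
                                             (Category._∘_ RefCoref (AxisHom.hom h) (AxisHom.hom f))
        homomorphism {X} {Y} {Z} {f} {h} =
            (refl , refl)
          , ( Z.i-mono _ _ (pullˡ Z.i∘r≈k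
                ○ sym (∘-resp-≈ʳ assoc ○ pullˡ Z.i∘r≈k
                       ○ ∘-resp-≈ʳ (assoc ○ ∘-resp-≈ʳ (pullˡ Y.i∘r≈k))
                       ○ Z.k-cong-ǧ (AxisHom.ǧ₂∘ǎ∘k₁∘ h) ○ ∘-resp-≈ʳ (sym assoc)))
            , X.i-mono _ _ (AxisHom.i₁∘ĉ (Category._∘_ AdjArrow h f) ○ assoc
                ○ sym (pullˡ (AxisHom.i₁∘ĉ f) ○ assoc ○ ∘-resp-≈ʳ (AxisHom.i₁∘ĉ h))))
          , (refl , refl)
          where
            module X = Axis (ArrowObj.arr X)
            module Y = Axis (ArrowObj.arr Y)
            module Z = Axis (ArrowObj.arr Z)

        resp-≈ : ∀ {X Y} {f f′ : Category._⇒_ AdjArrow X Y} → Category._≈_ AdjArrow f f′ →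
                 Category._≈_ RefCoref (AxisHom.hom f) (AxisHom.hom f′)
        resp-≈ {X} {f = f} {f′} ((lower≈ , upper≈) , bot≈) =
            (lower≈ , upper≈)
          , ( ∘-resp-≈ʳ (∘-resp-≈ˡ lower≈)
            , Axis.i-mono (ArrowObj.arr X) _ _
                (AxisHom.i₁∘ĉ f ○ ∘-resp-≈ˡ upper≈ ○ sym (AxisHom.i₁∘ĉ f′)))
          , bot≈

  module AxisOfComposite (X : Category.Obj RefCoref) where
    open FactObj X using (A; C; B; e; m; e∈L; m∈R)
    module ◇ₘₑ = Axis (m ∘ᴬ e)
    open ◇ₘₑ public using (i; k)
    ě : Car A ⇒ Car C
    ě = lower e
    ê : Car C ⇒ Car A
    ê = upper e
    m̌ : Car C ⇒ Car B
    m̌ = lower m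
    m̂ : Car B ⇒ Car C
    m̂ = upper m

    abstract
      k≈ê∘ě : k ≈ ê ∘ ě
      k≈ê∘ě = assoc ○ ∘-resp-≈ʳ (sym assoc ○ ∘-resp-≈ˡ m∈R ○ identityˡ)

      k∘ê≈ê : k ∘ ê ≈ ê
      k∘ê≈ê = ∘-resp-≈ˡ k≈ê∘ě ○ pullʳ e∈L ○ identityʳ

    u : Car C ⇒ ◇ₘₑ.E
    u = ◇ₘₑ.corestrict ê k∘ê≈ê

    abstract
      i∘u≈ê : i ∘ u ≈ ê
      i∘u≈ê = ◇ₘₑ.i∘corestrict ê k∘ê≈ê

      ě∘i∘u≈id : (ě ∘ i) ∘ u ≈ id
      ě∘i∘u≈id = pullʳ i∘u≈ê ○ e∈L

      u∘ě∘i≈id : u ∘ (ě ∘ i) ≈ id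
      u∘ě∘i≈id = ◇ₘₑ.i-mono _ _
        (pullˡ i∘u≈ê ○ sym assoc ○ ∘-resp-≈ˡ (sym k≈ê∘ě) ○ ◇ₘₑ.k∘i≈i ○ sym identityʳ)

    u-monotone : Monotone C ◇ₘₑ.◇ u
    u-monotone = ◇ₘₑ.◇.corestriction-monotone {C} u ê i∘u≈ê (upper-mono e)

    ě∘i-monotone : Monotone ◇ₘₑ.◇ C (ě ∘ i)
    ě∘i-monotone = mono-∘ {◇ₘₑ.◇} {A} {C} ◇ₘₑ.◇.i-monotone (lower-mono e)

    toAxis : Adjunction C ◇ₘₑ.◇
    toAxis = isoAdjunction u (ě ∘ i) u-monotone ě∘i-monotone ě∘i∘u≈id u∘ě∘i≈id

    fromAxis : Adjunction ◇ₘₑ.◇ C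
    fromAxis = isoAdjunction (ě ∘ i) u ě∘i-monotone u-monotone u∘ě∘i≈id ě∘i∘u≈id

    abstract
      r≈u∘ě : ◇ₘₑ.r ∘ id ≈ u ∘ ě
      r≈u∘ě = ◇ₘₑ.i-mono _ _
        (∘-resp-≈ʳ identityʳ ○ ◇ₘₑ.i∘r≈k ○ k≈ê∘ě ○ ∘-resp-≈ˡ (sym i∘u≈ê) ○ assoc)

      i≈ê∘ě∘i : id ∘ i ≈ ê ∘ (ě ∘ i)
      i≈ê∘ě∘i = identityˡ ○ sym ◇ₘₑ.k∘i≈i ○ ∘-resp-≈ˡ k≈ê∘ě ○ assoc

      m̌∘ě∘i∘u≈m̌ : (◇ₘₑ.ǧ ∘ i) ∘ u ≈ id ∘ m̌
      m̌∘ě∘i∘u≈m̌ = pullʳ i∘u≈ê ○ pullʳ e∈L ○ identityʳ ○ sym identityˡ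

      ě∘i∘s≈m̂ : (ě ∘ i) ∘ ◇ₘₑ.s ≈ m̂ ∘ id
      ě∘i∘s≈m̂ = pullʳ ◇ₘₑ.i∘s≈ĝ ○ sym assoc ○ ∘-resp-≈ˡ e∈L ○ identityˡ ○ sym identityʳ

      ě≈ě∘i∘r : ě ∘ id ≈ (ě ∘ i) ∘ ◇ₘₑ.r
      ě≈ě∘i∘r = identityʳ ○ sym (pullʳ ◇ₘₑ.i∘r≈k ○ ∘-resp-≈ʳ k≈ê∘ě ○ sym assoc
                                  ○ ∘-resp-≈ˡ e∈L ○ identityˡ)

      u∘m̂≈s : u ∘ m̂ ≈ ◇ₘₑ.s ∘ id
      u∘m̂≈s = ◇ₘₑ.i-mono _ _ (pullˡ i∘u≈ê ○ sym ◇ₘₑ.i∘s≈ĝ ○ ∘-resp-≈ʳ (sym identityʳ))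

    η : Category._⇒_ RefCoref X (Functor.F₀ (Polar ∘F Composition) X)
    η = factHom idAdj toAxis idAdj (r≈u∘ě , i≈ê∘ě∘i) (m̌∘ě∘i∘u≈m̌ , ě∘i∘s≈m̂)

    η⁻¹ : Category._⇒_ RefCoref (Functor.F₀ (Polar ∘F Composition) X) X
    η⁻¹ = factHom idAdj fromAxis idAdj
      (ě≈ě∘i∘r , identityˡ ○ sym i∘u≈ê) (sym assoc ○ sym identityˡ , u∘m̂≈s)

  module AxisOfCompositeNatural {X Y : Category.Obj RefCoref} (f : Category._⇒_ RefCoref X Y) where
    private
      module X = AxisOfComposite X
      module Y = AxisOfComposite Y
      module f = AxisHom (Functor.F₁ Composition f)
      open FactHom f using (c; square₁)

    abstract
      lower-natural : Y.u ∘ lower c ≈ f.č ∘ X.u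
      lower-natural = Y.◇ₘₑ.i-mono _ _ (pullˡ Y.i∘u≈ê ○ sym
        ( ∘-resp-≈ʳ assoc ○ pullˡ Y.◇ₘₑ.i∘r≈k ○ ∘-resp-≈ʳ (pullʳ X.i∘u≈ê)
        ○ ∘-resp-≈ˡ Y.k≈ê∘ě ○ assoc ○ ∘-resp-≈ʳ (pullˡ (proj₁ square₁))
        ○ ∘-resp-≈ʳ (pullʳ (FactObj.e∈L X) ○ identityʳ)))

      upper-natural : upper c ∘ (Y.ě ∘ Y.i) ≈ (X.ě ∘ X.i) ∘ f.ĉ
      upper-natural = sym
        ( pullʳ (f.i₁∘ĉ ○ ∘-resp-≈ʳ (sym Y.◇ₘₑ.k∘i≈i ○ ∘-resp-≈ˡ Y.k≈ê∘ě ○ assoc)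
                ○ pullˡ (proj₂ square₁) ○ assoc)
        ○ pullˡ (FactObj.e∈L X) ○ identityˡ)

  identity-commutes : ∀ {A B} {h : A ⇒ B} → id ∘ h ≈ h ∘ id
  identity-commutes = identityˡ ○ sym identityʳ

  unitIso : NaturalIsomorphism RefCoref RefCoref idF (Polar ∘F Composition)
  unitIso = record
    { η = AxisOfComposite.η
    ; η⁻¹ = AxisOfComposite.η⁻¹
    ; isoˡ = λ X → (identityˡ , identityˡ)
                 , (AxisOfComposite.ě∘i∘u≈id X , AxisOfComposite.ě∘i∘u≈id X)
                 , (identityˡ , identityˡ)
    ; isoʳ = λ X → (identityˡ , identityˡ)
                 , (AxisOfComposite.u∘ě∘i≈id X , AxisOfComposite.u∘ě∘i≈id X)
                 , (identityˡ , identityˡ)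
    ; natural = λ f → (identity-commutes , sym identity-commutes)
                    , (AxisOfCompositeNatural.lower-natural f , AxisOfCompositeNatural.upper-natural f)
                    , (identity-commutes , sym identity-commutes)
    }

  counitIso : NaturalIsomorphism AdjArrow AdjArrow (Composition ∘F Polar) idF
  counitIso = record
    { η = λ X → arrHom idAdj idAdj (recomposes X)
    ; η⁻¹ = λ X → arrHom idAdj idAdj (decomposes X)
    ; isoˡ = λ _ → (identityˡ , identityˡ) , (identityˡ , identityˡ)
    ; isoʳ = λ _ → (identityˡ , identityˡ) , (identityˡ , identityˡ)
    ; natural = λ _ → (identity-commutes , sym identity-commutes)
                    , (identity-commutes , sym identity-commutes)
    }
    where
      recomposes : ∀ (X : ArrowObj AdjCat) → let open Axis (ArrowObj.arr X) in
                   Category._≈_ AdjCat (ArrowObj.arr X ∘ᴬ idAdj) (idAdj ∘ᴬ (intent ∘ᴬ extent))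
      recomposes X = identityʳ ○ sym (proj₁ intent∘extent≈g) ○ sym identityˡ
                   , identityˡ ○ sym (proj₂ intent∘extent≈g) ○ sym identityʳ
        where open Axis (ArrowObj.arr X)
      decomposes : ∀ (X : ArrowObj AdjCat) → let open Axis (ArrowObj.arr X) in
                   Category._≈_ AdjCat ((intent ∘ᴬ extent) ∘ᴬ idAdj) (idAdj ∘ᴬ ArrowObj.arr X)
      decomposes X = identityʳ ○ proj₁ intent∘extent≈g ○ sym identityˡ
                   , identityˡ ○ proj₂ intent∘extent≈g ○ sym identityʳ
        where open Axis (ArrowObj.arr X)

  polar-equivalence : IsEquivalenceOfCategories Composition
  polar-equivalence = record { G = Polar ; unit = unitIso ; counit = counitIso }

theorem2 : ∀ {o ℓ ε} (𝓑 : Topos o ℓ ε) →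
    IsEquivalenceOfCategories (Internal.Composition 𝓑)
theorem2 𝓑 = PolarFactorization.polar-equivalence 𝓑
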